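{- Let $\mathcal{P}$ be a two-orbit $n$-polytope in the class $2_I$ with $N\setminus I=\{j_0,k_0\}$ and $k_0=j_0+2$, with base flag $\Phi$. Then \[\Gamma_{k_0}^-\cap\Gamma_{j_0}^+\alpha_{j_0,k_0}=\emptyset,\qquad\Gamma_{k_0}^-\cap\alpha_{k_0,j_0}\Gamma_{j_0}^+\alpha_{j_0,k_0}=\langle\alpha_{j_0,j_0+1,j_0}\rangle.\]
   Context: An (abstract) polytope of rank $n$ is a partially ordered set with a strictly monotone rank function onto $\{ -1,\ldots,n\}$, a unique least and unique greatest face, whose maximal chains (flags) each contain $n+2$ faces, satisfying the diamond condition and strong flag-connectedness. For a flag $\Phi$ and $i\in N:=\{0,\ldots,n-1\}$, $\Phi^i$ is the flag differing from $\Phi$ exactly in its $i$-face, $\Phi^{i_1,\ldots,i_l}:=(\Phi^{i_1,\ldots,i_{l-1}})^{i_l}$. $\Gamma(\mathcal{P})$ is the automorphism group, acting on the right. A two-orbit polytope is one whose automorphism group has exactly two flag orbits; it is in class $2_I$ where $I\subsetneq N$ is the (flag-independent) set of $i$ with $\Phi,\Phi^i$ in the same orbit. For $i\in I$, $j,k\in N\setminus I$ let $\rho_i,\alpha_{j,k},\alpha_{j,i,j}$ be the unique automorphisms with $\Phi\rho_i=\Phi^i$, $\Phi\alpha_{j,k}=\Phi^{j,k}$, $\Phi\alpha_{j,i,j}=\Phi^{j,i,j}$. For $l\in N$: $\Gamma_l^-:=\langle\rho_i,\alpha_{j,k},\alpha_{j,i,j}\mid i\in I,\ j,k\notin I,\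 i,j,k<l\rangle$ and $\Gamma_l^+:=\langle\rho_i,\alpha_{j,k},\alpha_{j,i,j}\mid i\in I,\ j,k\notin I,\ i,j,k>l\rangle$. -}

module Defs where

open import Data.Nat using (ℕ; suc; _+_)
open import Data.Fin using (Fin; zero; suc; toℕ; inject₁)
open import Data.Fin as Fin using ()
open import Data.Product using (Σ; ∃; _×_; _,_)
open import Data.Sum using (_⊎_)
open import Data.Empty using (⊥)
open import Relation.Nullary using (¬_)
open import Relation.Binary.PropositionalEquality using (_≡_; _≢_)
open import Relation.Binary.Structures using (IsPartialOrder)
open import Function.Bundles using (_⇔_)
open import Function.Definitions using (Injective)

-- Abstract polytopes of rank n.
-- Ranks -1,0,…,n are encoded by indices 0,1,…,n+1 of Fin (2 + n):
-- index r ∈ Fin (2+n) stands for rank (toℕ r - 1).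

record Polytope (n : ℕ) : Set₁ where
  field
    Face   : Set
    _≤_    : Face → Face → Set
    isPartialOrder : IsPartialOrder _≡_ _≤_
    rank   : Face → Fin (2 + n)

  _<_ : Face → Face → Set
  F < G = (F ≤ G) × (F ≢ G)

  IsChain : (Face → Set) → Set
  IsChain C = ∀ F G → C F → C G → (F ≤ G) ⊎ (G ≤ F)

  IsMaximalChain : (Face → Set) → Set
  IsMaximalChain C = IsChain C × (∀ H → (∀ F → C F → (F ≤ H) ⊎ (H ≤ F)) → C H)

  HasSize : (Face → Set) → ℕ → Set
  HasSize C m = Σ (Fin m → Face) λ f → Injective _≡_ _≡_ f × (∀ F → C F ⇔ (∃ λ i → f i ≡ F))

  field
    rank-strict : ∀ {F G} → F < G → rank F Fin.< rank G
    rank-onto   : ∀ r → ∃ λ F → rank F ≡ r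
    -- unique least and unique greatest face (uniqueness by antisymmetry)
    least    : ∃ λ F → ∀ G → F ≤ G
    greatest : ∃ λ F → ∀ G → G ≤ F
    flags-size : ∀ C → IsMaximalChain C → HasSize C (2 + n)
    diamond : ∀ F G → F < G → toℕ (rank G) ≡ 2 + toℕ (rank F) →
              Σ Face λ H₁ → Σ Face λ H₂ → H₁ ≢ H₂ ×
                (F < H₁ × H₁ < G) × (F < H₂ × H₂ < G) ×
                (∀ H → F < H → H < G → (H ≡ H₁) ⊎ (H ≡ H₂))

  -- Flags, represented by the rank-indexed list of their faces:
  -- Φ r is the face of (encoded) rank r of the flag.
  FlagFn : Set
  FlagFn = Fin (2 + n) → Face

  IsFlag : FlagFn → Set
  IsFlag Φ = (∀ r → rank (Φ r) ≡ r) × (∀ r s → r Fin.≤ s → Φ r ≤ Φ s)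

  -- position of the i-face, i ∈ N = {0,…,n-1}
  pos : Fin n → Fin (2 + n)
  pos i = suc (inject₁ i)

  Adj : Fin n → FlagFn → FlagFn → Set
  Adj i Φ Ψ = (Φ (pos i) ≢ Ψ (pos i)) × (∀ r → r ≢ pos i → Φ r ≡ Ψ r)

  Adj2 : Fin n → Fin n → FlagFn → FlagFn → Set
  Adj2 j k Φ Θ = Σ FlagFn λ Ψ → IsFlag Ψ × Adj j Φ Ψ × Adj k Ψ Θ

  Adj3 : Fin n → Fin n → Fin n → FlagFn → FlagFn → Set
  Adj3 j i l Φ Θ = Σ FlagFn λ Ψ₁ → Σ FlagFn λ Ψ₂ →
    IsFlag Ψ₁ × IsFlag Ψ₂ × Adj j Φ Ψ₁ × Adj i Ψ₁ Ψ₂ × Adj l Ψ₂ Θ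

  Keeps : FlagFn → FlagFn → FlagFn → Set
  Keeps Φ Ψ Θ = ∀ r → Φ r ≡ Ψ r → Θ r ≡ Φ r

  StrongPath : FlagFn → FlagFn → Set
  StrongPath Φ Ψ = Σ ℕ λ k → Σ (Fin (suc k) → FlagFn) λ Θ →
    (∀ r → Θ zero r ≡ Φ r) × (∀ r → Θ (Fin.fromℕ k) r ≡ Ψ r) ×
    (∀ m → IsFlag (Θ m)) × (∀ m → Keeps Φ Ψ (Θ m)) ×
    (∀ (m : Fin k) → ∃ λ i → Adj i (Θ (inject₁ m)) (Θ (suc m)))

  field
    strongly-flag-connected : ∀ Φ Ψ → IsFlag Φ → IsFlag Ψ → StrongPath Φ Ψ

module _ {n : ℕ} (P : Polytope n) where
  open Polytope P

  record Aut : Set where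
    field
      to      : Face → Face
      from    : Face → Face
      to-from : ∀ F → to (from F) ≡ F
      from-to : ∀ F → from (to F) ≡ F
      to-mono   : ∀ {F G} → F ≤ G → to F ≤ to G
      from-mono : ∀ {F G} → F ≤ G → from F ≤ from G
  open Aut public

  _≈_ : Aut → Aut → Set
  g ≈ h = ∀ F → to g F ≡ to h F

  _·ᶠ_ : FlagFn → Aut → FlagFn
  (Φ ·ᶠ γ) r = to γ (Φ r)

  idA : Aut
  idA = record { to = λ F → F ; from = λ F → F
               ; to-from = λ _ → Relation.Binary.PropositionalEquality.refl
               ; from-to = λ _ → Relation.Binary.PropositionalEquality.refl
               ; to-mono = λ p → p ; from-mono = λ p → p }

  -- product for a right action:  Φ (g · h) = (Φ g) h
  _·_ : Aut → Aut → Aut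
  g · h = record
    { to = λ F → to h (to g F) ; from = λ F → from g (from h F)
    ; to-from = λ F → Relation.Binary.PropositionalEquality.trans
        (Relation.Binary.PropositionalEquality.cong (to h) (to-from g (from h F))) (to-from h F)
    ; from-to = λ F → Relation.Binary.PropositionalEquality.trans
        (Relation.Binary.PropositionalEquality.cong (from g) (from-to h (to g F))) (from-to g F)
    ; to-mono = λ p → to-mono h (to-mono g p)
    ; from-mono = λ p → from-mono g (from-mono h p) }

  _⁻¹ : Aut → Aut
  g ⁻¹ = record { to = from g ; from = to g ; to-from = from-to g ; from-to = to-from g
                ; to-mono = from-mono g ; from-mono = to-mono g }

  data ⟨_⟩ (S : Aut → Set) : Aut → Set where
    gen  : ∀ {g} → S g → ⟨ S ⟩ g
    one  : ⟨ S ⟩ idA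
    mul  : ∀ {g h} → ⟨ S ⟩ g → ⟨ S ⟩ h → ⟨ S ⟩ (g · h)
    inv  : ∀ {g} → ⟨ S ⟩ g → ⟨ S ⟩ (g ⁻¹)
    resp : ∀ {g h} → g ≈ h → ⟨ S ⟩ g → ⟨ S ⟩ h

  SameOrbit : FlagFn → FlagFn → Set
  SameOrbit Φ Ψ = ∃ λ γ → ∀ r → (Φ ·ᶠ γ) r ≡ Ψ r

  TwoOrbit : Set
  TwoOrbit = Σ FlagFn λ Φ₁ → Σ FlagFn λ Ψ₁ → IsFlag Φ₁ × IsFlag Ψ₁ ×
    ¬ SameOrbit Φ₁ Ψ₁ × (∀ Θ → IsFlag Θ → SameOrbit Φ₁ Θ ⊎ SameOrbit Ψ₁ Θ)

  InClass2 : (Fin n → Set) → FlagFn → Set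
  InClass2 I Φ = TwoOrbit × IsFlag Φ ×
    (∀ i Ψ → IsFlag Ψ → Adj i Φ Ψ → (SameOrbit Φ Ψ ⇔ I i))

  -- generators ρ_i, α_{j,k}, α_{j,i,j} (w.r.t. base flag Φ) with indices < l
  GenMinus : (Fin n → Set) → FlagFn → Fin n → Aut → Set
  GenMinus I Φ l γ =
      (Σ (Fin n) λ i → I i × i Fin.< l × Adj i Φ (Φ ·ᶠ γ))
    ⊎ (Σ (Fin n) λ j → Σ (Fin n) λ k → ¬ I j × ¬ I k × j Fin.< l × k Fin.< l ×
         Adj2 j k Φ (Φ ·ᶠ γ))
    ⊎ (Σ (Fin n) λ j → Σ (Fin n) λ i → ¬ I j × I i × j Fin.< l × i Fin.< l ×
         Adj3 j i j Φ (Φ ·ᶠ γ))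

  GenPlus : (Fin n → Set) → FlagFn → Fin n → Aut → Set
  GenPlus I Φ l γ =
      (Σ (Fin n) λ i → I i × l Fin.< i × Adj i Φ (Φ ·ᶠ γ))
    ⊎ (Σ (Fin n) λ j → Σ (Fin n) λ k → ¬ I j × ¬ I k × l Fin.< j × l Fin.< k ×
         Adj2 j k Φ (Φ ·ᶠ γ))
    ⊎ (Σ (Fin n) λ j → Σ (Fin n) λ i → ¬ I j × I i × l Fin.< j × l Fin.< i ×
         Adj3 j i j Φ (Φ ·ᶠ γ))

  Γ⁻ : (Fin n → Set) → FlagFn → Fin n → Aut → Set
  Γ⁻ I Φ l = ⟨ GenMinus I Φ l ⟩

  Γ⁺ : (Fin n → Set) → FlagFn → Fin n → Aut → Set
  Γ⁺ I Φ l = ⟨ GenPlus I Φ l ⟩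

{-# OPTIONS --safe #-}
-- Write A = Φ^{j₀} and m = j₀ + 1.  As j₀ ∉ I, A is not in the orbit of Φ, while m ∈ I.  Elements of
-- Γ⁻_{k₀} fix the faces of Φ of rank ≥ k₀, elements of Γ⁺_{j₀} those of rank ≤ j₀.  So if g ∈ Γ⁻_{k₀}
-- equals d α_{j₀,k₀}, resp. α_{k₀,j₀} d α_{j₀,k₀} (note α_{j₀,k₀} α_{k₀,j₀} fixes Φ), with d ∈ Γ⁺_{j₀},
-- then Φg, resp. Ag, agrees with A except possibly in its m-face: since k₀ = j₀ + 2 every other face has
-- rank ≤ j₀ or ≥ k₀.  By the diamond condition it is then A or A^m.  In the first situation both cases
-- put A into the orbit of Φ.  In the second, Ag = A^m says Φg = Φ^{j₀,m,j₀}, and Ag = A forces Φg = Φ,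
-- whence g = (gα)α⁻¹ for α = α_{j₀,m,j₀}, which exists because Φ^{j₀,m,j₀} lies in the orbit of Φ.
-- Conversely α_{k₀,j₀}⁻¹ g α_{j₀,k₀}⁻¹ = (α_{j₀,k₀} α_{k₀,j₀})⁻¹ · α_{j₀,k₀} g α_{j₀,k₀}⁻¹, and
-- conjugation by α_{j₀,k₀} maps α_{j₀,m,j₀} to α_{k₀,m,k₀} ∈ Γ⁺_{j₀}.
module Submission where

open import Defs
open import Data.Nat using (ℕ; suc; _+_)
open import Data.Fin using (Fin; toℕ)
open import Data.Product using (Σ; ∃; _×_; _,_)
open import Relation.Nullary using (¬_)
open import Relation.Binary.PropositionalEquality using (_≡_; _≢_)
open import Function.Bundles using (_⇔_)

import Data.Nat.Base as ℕ
import Data.Nat.Properties as ℕ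
open import Data.Fin.Base using (inject₁; fromℕ<)
import Data.Fin.Base as Fin
import Data.Fin.Properties as Fin
open import Data.Fin.Induction using (<-weakInduction; >-weakInduction)
open import Data.Vec.Functional using (updateAt)
open import Data.Vec.Functional.Properties using (updateAt-updates; updateAt-minimal)
open import Data.Product using (proj₁; proj₂; map₂)
open import Data.Sum using (_⊎_; inj₁; inj₂; [_,_]′)
open import Function.Base using (_∘_; const; id)
open import Function.Bundles using (mk⇔; module Equivalence)
open import Relation.Nullary using (yes; no; contradiction)
open import Relation.Binary.PropositionalEquality
  using (refl; sym; trans; cong; subst; subst₂; _≗_; module ≡-Reasoning)
open import Relation.Binary.Structures using (IsPartialOrder)
open import Relation.Binary.Definitions using (tri<; tri≈; tri>)

strictMono⇒id : ∀ {m} (f : Fin (suc m) → Fin (suc m)) →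
                (∀ {i j} → i Fin.< j → f i Fin.< f j) → ∀ i → f i ≡ i
strictMono⇒id f mono i = Fin.≤-antisym (>-weakInduction (λ i → f i Fin.≤ i) (Fin.≤fromℕ _) down i)
                                       (<-weakInduction (λ i → i Fin.≤ f i) ℕ.z≤n up i)
  where
  inject₁<suc : ∀ i → inject₁ i Fin.< Fin.suc i
  inject₁<suc i = ℕ.s≤s (ℕ.≤-reflexive (Fin.toℕ-inject₁ i))

  up : ∀ i → inject₁ i Fin.≤ f (inject₁ i) → Fin.suc i Fin.≤ f (Fin.suc i)
  up i ih = subst (λ k → suc k ℕ.≤ toℕ (f (Fin.suc i))) (Fin.toℕ-inject₁ i)
                  (ℕ.≤-<-trans ih (mono (inject₁<suc i)))

  down : ∀ i → f (Fin.suc i) Fin.≤ Fin.suc i → f (inject₁ i) Fin.≤ inject₁ i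
  down i ih = subst (toℕ (f (inject₁ i)) ℕ.≤_) (sym (Fin.toℕ-inject₁ i))
                    (ℕ.≤-pred (ℕ.<-≤-trans (mono (inject₁<suc i)) ih))

module _ {n : ℕ} (P : Polytope n) where
  open Polytope P
  open IsPartialOrder isPartialOrder using () renaming (refl to ≤-refl; trans to ≤-trans)

  infixl 7 _∙_
  _∙_ : Aut P → Aut P → Aut P
  _∙_ = _·_ P

  infix 8 _⁻¹ᴬ
  _⁻¹ᴬ : Aut P → Aut P
  _⁻¹ᴬ = _⁻¹ P

  infixl 6 _⋆_
  _⋆_ : FlagFn → Aut P → FlagFn
  _⋆_ = _·ᶠ_ P

  private variable
    i j l : Fin n
    r s : Fin (2 + n)
    F G H : Face
    Θ Θ₁ Θ₂ Ψ Ψ₁ Ψ₂ Φ : FlagFn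
    x γ g : Aut P
    S T : Aut P → Set

  to-injective : (x : Aut P) → to x F ≡ to x G → F ≡ G
  to-injective {F} {G} x eq = trans (sym (from-to x F)) (trans (cong (from x) eq) (from-to x G))

  to-< : (x : Aut P) → F < G → to x F < to x G
  to-< x (F≤G , F≢G) = to-mono x F≤G , F≢G ∘ to-injective x

  flag-< : IsFlag Θ → r Fin.< s → Θ r < Θ s
  flag-< (rank-Θ , mono) r<s =
    mono _ _ (ℕ.<⇒≤ r<s) ,
    λ eq → Fin.<⇒≢ r<s (trans (sym (rank-Θ _)) (trans (cong rank eq) (rank-Θ _)))

  isFlag-⋆ : (x : Aut P) → IsFlag Θ → IsFlag (Θ ⋆ x)
  isFlag-⋆ {Θ} x Θ-flag@(_ , mono) =
    strictMono⇒id (λ r → rank (to x (Θ r))) (rank-strict ∘ to-< x ∘ flag-< Θ-flag) ,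
    λ r s r≤s → to-mono x (mono r s r≤s)

  ≗-at-and-off : (p : Fin (2 + n)) → Θ p ≡ Ψ p → (∀ r → r ≢ p → Θ r ≡ Ψ r) → Θ ≗ Ψ
  ≗-at-and-off p at off r with r Fin.≟ p
  ... | yes refl = at
  ... | no r≢p = off r r≢p

  Adj-sym : Adj i Θ Ψ → Adj i Ψ Θ
  Adj-sym (differ , agree) = differ ∘ sym , λ r r≢ → sym (agree r r≢)

  Adj-⋆ : (x : Aut P) → Adj i Θ Ψ → Adj i (Θ ⋆ x) (Ψ ⋆ x)
  Adj-⋆ x (differ , agree) = differ ∘ to-injective x , λ r r≢ → cong (to x) (agree r r≢)

  Adj-resp : Θ ≗ Θ₁ → Ψ ≗ Ψ₁ → Adj i Θ Ψ → Adj i Θ₁ Ψ₁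
  Adj-resp {i = i} Θ≗ Ψ≗ (differ , agree) =
    (λ eq → differ (trans (Θ≗ (pos i)) (trans eq (sym (Ψ≗ (pos i)))))) ,
    λ r r≢ → trans (sym (Θ≗ r)) (trans (agree r r≢) (Ψ≗ r))

  below above : Fin n → Fin (2 + n)
  below i = inject₁ (inject₁ i)
  above i = Fin.suc (Fin.suc i)

  below<pos : below i Fin.< pos i
  below<pos {i} = ℕ.s≤s (ℕ.≤-reflexive (Fin.toℕ-inject₁ (inject₁ i)))

  pos<above : pos i Fin.< above i
  pos<above {i} = ℕ.s≤s (ℕ.s≤s (ℕ.≤-reflexive (Fin.toℕ-inject₁ i)))

  <pos⇒≤below : r Fin.< pos i → r Fin.≤ below i
  <pos⇒≤below {r} {i} r<pos = subst (toℕ r ℕ.≤_) (sym (Fin.toℕ-inject₁ (inject₁ i))) (ℕ.≤-pred r<pos)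

  pos<⇒above≤ : pos i Fin.< r → above i Fin.≤ r
  pos<⇒above≤ {i} {r} pos<r = subst (λ k → suc (suc k) ℕ.≤ toℕ r) (Fin.toℕ-inject₁ i) pos<r

  between⇒pos : below i Fin.< r → r Fin.< above i → r ≡ pos i
  between⇒pos {i} {r} below<r r<above = Fin.≤-antisym
    (subst (λ k → toℕ r ℕ.≤ suc k) (sym (Fin.toℕ-inject₁ i)) (ℕ.≤-pred r<above))
    (subst (λ k → suc k ℕ.≤ toℕ r) (Fin.toℕ-inject₁ (inject₁ i)) below<r)

  below≢pos : below i ≢ pos i
  below≢pos = Fin.<⇒≢ below<pos

  above≢pos : above i ≢ pos i
  above≢pos = Fin.<⇒≢ pos<above ∘ sym

  Between : FlagFn → Fin n → Face → Set
  Between Θ i H = Θ (below i) < H × H < Θ (above i)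

  module _ {Θ : FlagFn} (Θ-flag : IsFlag Θ) (i : Fin n) where
    private
      rank-gap : toℕ (rank (Θ (above i))) ≡ 2 + toℕ (rank (Θ (below i)))
      rank-gap = begin
        toℕ (rank (Θ (above i)))     ≡⟨ cong toℕ (proj₁ Θ-flag (above i)) ⟩
        2 + toℕ i                    ≡⟨ cong (2 +_) (sym (trans (Fin.toℕ-inject₁ _) (Fin.toℕ-inject₁ i))) ⟩
        2 + toℕ (below i)            ≡⟨ cong (λ r → 2 + toℕ r) (sym (proj₁ Θ-flag (below i))) ⟩
        2 + toℕ (rank (Θ (below i))) ∎
        where open ≡-Reasoning

      diamond-at : Σ Face λ H₁ → Σ Face λ H₂ → H₁ ≢ H₂ × Between Θ i H₁ × Between Θ i H₂ ×
                   (∀ H → Θ (below i) < H → H < Θ (above i) → H ≡ H₁ ⊎ H ≡ H₂)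
      diamond-at = diamond _ _ (flag-< Θ-flag (Fin.<-trans below<pos pos<above)) rank-gap

    between-≡⊎≢ : Between Θ i F → Between Θ i G → F ≡ G ⊎ F ≢ G
    between-≡⊎≢ (F> , F<) (G> , G<) with diamond-at
    ... | _ , _ , H₁≢H₂ , _ , _ , only with only _ F> F< | only _ G> G<
    ... | inj₁ refl | inj₁ refl = inj₁ refl
    ... | inj₂ refl | inj₂ refl = inj₁ refl
    ... | inj₁ refl | inj₂ refl = inj₂ H₁≢H₂
    ... | inj₂ refl | inj₁ refl = inj₂ (H₁≢H₂ ∘ sym)

    between-unique : Between Θ i F → Between Θ i G → Between Θ i H → F ≢ H → G ≢ H → F ≡ G
    between-unique (F> , F<) (G> , G<) (H> , H<) F≢H G≢H with diamond-at
    ... | _ , _ , _ , _ , _ , only with only _ F> F< | only _ G> G< | only _ H> H<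
    ... | inj₁ refl | inj₁ refl | _         = refl
    ... | inj₂ refl | inj₂ refl | _         = refl
    ... | inj₁ refl | inj₂ refl | inj₁ refl = contradiction refl F≢H
    ... | inj₂ refl | inj₁ refl | inj₂ refl = contradiction refl F≢H
    ... | inj₁ refl | inj₂ refl | inj₂ refl = contradiction refl G≢H
    ... | inj₂ refl | inj₁ refl | inj₁ refl = contradiction refl G≢H

    between-other : ∃ λ H → Between Θ i H × H ≢ Θ (pos i)
    between-other with diamond-at
    ... | H₁ , H₂ , H₁≢H₂ , H₁-between , H₂-between , only
        with only (Θ (pos i)) (flag-< Θ-flag below<pos) (flag-< Θ-flag pos<above)
    ... | inj₁ refl = H₂ , H₂-between , H₁≢H₂ ∘ sym
    ... | inj₂ refl = H₁ , H₁-between , H₁≢H₂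

  agree⇒between : IsFlag Ψ → (∀ r → r ≢ pos i → Θ r ≡ Ψ r) → Between Θ i (Ψ (pos i))
  agree⇒between {Ψ} Ψ-flag agree =
    subst (_< Ψ (pos _)) (sym (agree _ below≢pos)) (flag-< Ψ-flag below<pos) ,
    subst (Ψ (pos _) <_) (sym (agree _ above≢pos)) (flag-< Ψ-flag pos<above)

  Adj-unique : IsFlag Θ → IsFlag Ψ₁ → IsFlag Ψ₂ → Adj i Θ Ψ₁ → Adj i Θ Ψ₂ → Ψ₁ ≗ Ψ₂
  Adj-unique {i = i} Θ-flag Ψ₁-flag Ψ₂-flag (Ψ₁≢ , Ψ₁-agree) (Ψ₂≢ , Ψ₂-agree) =
    ≗-at-and-off (pos i)
      (between-unique Θ-flag i (agree⇒between Ψ₁-flag Ψ₁-agree) (agree⇒between Ψ₂-flag Ψ₂-agree)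
                      (agree⇒between Θ-flag (λ _ _ → refl)) (Ψ₁≢ ∘ sym) (Ψ₂≢ ∘ sym))
      (λ r r≢ → trans (sym (Ψ₁-agree r r≢)) (Ψ₂-agree r r≢))

  ≗⊎Adj : IsFlag Θ → IsFlag Ψ → (∀ r → r ≢ pos i → Θ r ≡ Ψ r) → Θ ≗ Ψ ⊎ Adj i Θ Ψ
  ≗⊎Adj {i = i} Θ-flag Ψ-flag agree
    with between-≡⊎≢ Θ-flag i (agree⇒between Θ-flag (λ _ _ → refl)) (agree⇒between Ψ-flag agree)
  ... | inj₁ eq = inj₁ (≗-at-and-off (pos i) eq agree)
  ... | inj₂ ne = inj₂ (ne , agree)

  isFlag-updateAt : IsFlag Θ → Between Θ i H → IsFlag (updateAt Θ (pos i) (const H))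
  isFlag-updateAt {Θ} {i} {H} (rank-Θ , mono) (H> , H<) = rank-Θ′ , mono′
    where
    Θ′ : FlagFn
    Θ′ = updateAt Θ (pos i) (const H)

    at : Θ′ (pos i) ≡ H
    at = updateAt-updates (pos i) Θ

    off : r ≢ pos i → Θ′ r ≡ Θ r
    off r≢ = updateAt-minimal _ (pos i) Θ r≢

    rank-Θ′ : ∀ r → rank (Θ′ r) ≡ r
    rank-Θ′ r with r Fin.≟ pos i
    ... | yes refl = trans (cong rank at)
                           (between⇒pos (subst (Fin._< rank H) (rank-Θ _) (rank-strict H>))
                                        (subst (rank H Fin.<_) (rank-Θ _) (rank-strict H<)))
    ... | no r≢ = trans (cong rank (off r≢)) (rank-Θ r)

    mono′ : ∀ r s → r Fin.≤ s → Θ′ r ≤ Θ′ s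
    mono′ r s r≤s with r Fin.≟ pos i | s Fin.≟ pos i
    ... | yes refl | yes refl = ≤-refl
    ... | yes refl | no s≢ = subst₂ _≤_ (sym at) (sym (off s≢))
            (≤-trans (proj₁ H<) (mono _ s (pos<⇒above≤ (Fin.≤∧≢⇒< r≤s (s≢ ∘ sym)))))
    ... | no r≢ | yes refl = subst₂ _≤_ (sym (off r≢)) (sym at)
            (≤-trans (mono r _ (<pos⇒≤below (Fin.≤∧≢⇒< r≤s r≢))) (proj₁ H>))
    ... | no r≢ | no s≢ = subst₂ _≤_ (sym (off r≢)) (sym (off s≢)) (mono r s r≤s)

  Adj-exists : IsFlag Θ → (i : Fin n) → ∃ λ Ψ → IsFlag Ψ × Adj i Θ Ψ
  Adj-exists {Θ} Θ-flag i with between-other Θ-flag i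
  ... | H , H-between , H≢ =
    updateAt Θ (pos i) (const H) , isFlag-updateAt Θ-flag H-between ,
    (λ eq → H≢ (sym (trans eq (updateAt-updates (pos i) Θ)))) ,
    λ r r≢ → sym (updateAt-minimal r (pos i) Θ r≢)

  Adj2-inverse : IsFlag Φ → ∀ a b → Adj2 i l Φ (Φ ⋆ a) → Adj2 l i Φ (Φ ⋆ b) → Φ ⋆ (a ∙ b) ≗ Φ
  Adj2-inverse Φ-flag a b (A , A-flag , Φ~A , A~Φa) (B , B-flag , Φ~B , B~Φb) =
    Adj-unique B-flag (isFlag-⋆ (a ∙ b) Φ-flag) Φ-flag
               (Adj-resp Ab≗B (λ _ → refl) (Adj-⋆ b A~Φa)) (Adj-sym Φ~B)
    where
    Ab≗B : A ⋆ b ≗ B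
    Ab≗B = Adj-unique (isFlag-⋆ b Φ-flag) (isFlag-⋆ b A-flag) B-flag (Adj-⋆ b Φ~A) (Adj-sym B~Φb)

  Adj2-back : IsFlag Ψ → Adj i Θ Ψ → Θ ≗ Θ₁ → Adj2 i i Θ Θ₁
  Adj2-back Ψ-flag Θ~Ψ Θ≗Θ₁ = _ , Ψ-flag , Θ~Ψ , Adj-resp (λ _ → refl) Θ≗Θ₁ (Adj-sym Θ~Ψ)

  Adj3-respʳ : Ψ ≗ Ψ₁ → Adj3 i j l Θ Ψ → Adj3 i j l Θ Ψ₁
  Adj3-respʳ Ψ≗Ψ₁ (Θ₁ , Θ₂ , Θ₁-flag , Θ₂-flag , adj₁ , adj₂ , adj₃) =
    Θ₁ , Θ₂ , Θ₁-flag , Θ₂-flag , adj₁ , adj₂ , Adj-resp (λ _ → refl) Ψ≗Ψ₁ adj₃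

  Adj3-middle : IsFlag Φ → IsFlag Ψ → Adj i Φ Ψ → ∀ γ → Adj3 i j i Φ (Φ ⋆ γ) → Adj j Ψ (Ψ ⋆ γ)
  Adj3-middle {Ψ = Ψ} Φ-flag Ψ-flag Φ~Ψ γ (Θ₁ , Θ₂ , Θ₁-flag , Θ₂-flag , Φ~Θ₁ , Θ₁~Θ₂ , Θ₂~Φγ) =
    Adj-resp (sym ∘ Ψ≗Θ₁) (λ r → trans (sym (Θ₁γ≗Θ₂ r)) (cong (to γ) (sym (Ψ≗Θ₁ r)))) Θ₁~Θ₂
    where
    Ψ≗Θ₁ : Ψ ≗ Θ₁
    Ψ≗Θ₁ = Adj-unique Φ-flag Ψ-flag Θ₁-flag Φ~Ψ Φ~Θ₁

    Θ₁γ≗Θ₂ : Θ₁ ⋆ γ ≗ Θ₂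
    Θ₁γ≗Θ₂ = Adj-unique (isFlag-⋆ γ Φ-flag) (isFlag-⋆ γ Θ₁-flag) Θ₂-flag
                        (Adj-⋆ γ Φ~Θ₁) (Adj-sym Θ₂~Φγ)

  Adj3-conj : IsFlag Ψ → ∀ x → Adj l Ψ (Φ ⋆ x) → ∀ γ → Adj j Ψ (Ψ ⋆ γ) →
              Adj3 l j l Φ (Φ ⋆ ((x ∙ γ) ∙ x ⁻¹ᴬ))
  Adj3-conj {Ψ} {Φ = Φ} Ψ-flag x Ψ~Φx γ Ψ~Ψγ =
    Ψ ⋆ x ⁻¹ᴬ , Ψ ⋆ γ ⋆ x ⁻¹ᴬ , isFlag-⋆ (x ⁻¹ᴬ) Ψ-flag , isFlag-⋆ (x ⁻¹ᴬ) (isFlag-⋆ γ Ψ-flag) ,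
    Adj-resp (λ r → from-to x (Φ r)) (λ _ → refl) (Adj-⋆ (x ⁻¹ᴬ) (Adj-sym Ψ~Φx)) ,
    Adj-⋆ (x ⁻¹ᴬ) Ψ~Ψγ ,
    Adj-⋆ (x ⁻¹ᴬ) (Adj-⋆ γ Ψ~Φx)

  ⁻¹-fixes : ∀ x → Φ ⋆ x ≗ Φ → Φ ⋆ x ⁻¹ᴬ ≗ Φ
  ⁻¹-fixes {Φ} x Φx≗Φ r = trans (cong (from x) (sym (Φx≗Φ r))) (from-to x (Φ r))

  SameOrbit-sym : SameOrbit P Θ Ψ → SameOrbit P Ψ Θ
  SameOrbit-sym {Θ} (x , Θx≗Ψ) = x ⁻¹ᴬ , λ r → trans (cong (from x) (sym (Θx≗Ψ r))) (from-to x (Θ r))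

  SameOrbit-trans : SameOrbit P Θ Θ₁ → SameOrbit P Θ₁ Ψ → SameOrbit P Θ Ψ
  SameOrbit-trans (x , Θx≗Θ₁) (y , Θ₁y≗Ψ) = x ∙ y , λ r → trans (cong (to y) (Θx≗Θ₁ r)) (Θ₁y≗Ψ r)

  SameOrbit-common : SameOrbit P Θ Θ₁ → SameOrbit P Θ Θ₂ → SameOrbit P Θ₁ Θ₂
  SameOrbit-common o₁ o₂ = SameOrbit-trans (SameOrbit-sym o₁) o₂

  atMostTwoOrbits : TwoOrbit P → IsFlag Θ → IsFlag Θ₁ → IsFlag Θ₂ →
                    SameOrbit P Θ Θ₁ ⊎ SameOrbit P Θ Θ₂ ⊎ SameOrbit P Θ₁ Θ₂
  atMostTwoOrbits (_ , _ , _ , _ , _ , cover) Θ-flag Θ₁-flag Θ₂-flag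
    with cover _ Θ-flag | cover _ Θ₁-flag | cover _ Θ₂-flag
  ... | inj₁ o | inj₁ o₁ | _      = inj₁ (SameOrbit-common o o₁)
  ... | inj₂ o | inj₂ o₁ | _      = inj₁ (SameOrbit-common o o₁)
  ... | inj₁ o | inj₂ _  | inj₁ o₂ = inj₂ (inj₁ (SameOrbit-common o o₂))
  ... | inj₂ o | inj₁ _  | inj₂ o₂ = inj₂ (inj₁ (SameOrbit-common o o₂))
  ... | inj₁ _ | inj₂ o₁ | inj₂ o₂ = inj₂ (inj₂ (SameOrbit-common o₁ o₂))
  ... | inj₂ _ | inj₁ o₁ | inj₁ o₂ = inj₂ (inj₂ (SameOrbit-common o₁ o₂))

  FixesOn : (Fin (2 + n) → Set) → FlagFn → Aut P → Set
  FixesOn R Θ x = ∀ r → R r → to x (Θ r) ≡ Θ r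

  ⟨⟩-mono : (∀ {γ} → S γ → T γ) → ⟨_⟩ P S g → ⟨_⟩ P T g
  ⟨⟩-mono S⊆T (gen s)     = gen (S⊆T s)
  ⟨⟩-mono S⊆T one         = one
  ⟨⟩-mono S⊆T (mul p q)   = mul (⟨⟩-mono S⊆T p) (⟨⟩-mono S⊆T q)
  ⟨⟩-mono S⊆T (inv p)     = inv (⟨⟩-mono S⊆T p)
  ⟨⟩-mono S⊆T (resp eq p) = resp eq (⟨⟩-mono S⊆T p)

  ⟨⟩-fixes : ∀ {R} → (∀ γ → S γ → FixesOn R Θ γ) → ⟨_⟩ P S g → FixesOn R Θ g
  ⟨⟩-fixes fix (gen s)             = fix _ s
  ⟨⟩-fixes fix one r _             = refl
  ⟨⟩-fixes fix (mul {h = h} p q) r Rr =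
    trans (cong (to h) (⟨⟩-fixes fix p r Rr)) (⟨⟩-fixes fix q r Rr)
  ⟨⟩-fixes fix (inv {g} p) r Rr    = trans (cong (from g) (sym (⟨⟩-fixes fix p r Rr))) (from-to g _)
  ⟨⟩-fixes fix (resp eq p) r Rr    = trans (sym (eq _)) (⟨⟩-fixes fix p r Rr)

  ⟨⟩-conj : (x : Aut P) → (∀ γ → S γ → T ((x ∙ γ) ∙ x ⁻¹ᴬ)) →
            ⟨_⟩ P S g → ⟨_⟩ P T ((x ∙ g) ∙ x ⁻¹ᴬ)
  ⟨⟩-conj x S⇒T (gen s)           = gen (S⇒T _ s)
  ⟨⟩-conj x S⇒T one               = resp (λ F → sym (from-to x F)) one
  ⟨⟩-conj x S⇒T (mul {h = h} p q) =
    resp (λ F → cong (from x ∘ to h) (to-from x _)) (mul (⟨⟩-conj x S⇒T p) (⟨⟩-conj x S⇒T q))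
  ⟨⟩-conj x S⇒T (inv p)           = resp (λ _ → refl) (inv (⟨⟩-conj x S⇒T p))
  ⟨⟩-conj x S⇒T (resp eq p)       = resp (λ F → cong (from x) (eq (to x F))) (⟨⟩-conj x S⇒T p)

  fixer∈⟨⟩ : (∀ x y → Φ ⋆ x ≗ Φ ⋆ y → S x → S y) → ∃ S → Φ ⋆ g ≗ Φ → ⟨_⟩ P S g
  fixer∈⟨⟩ {g = g} S-resp (α , α∈S) Φg≗Φ =
    resp (λ F → from-to α (to g F))
         (mul (gen (S-resp α (g ∙ α) (λ r → cong (to α) (sym (Φg≗Φ r))) α∈S)) (inv (gen α∈S)))

  pos-< : i Fin.< l → pos i Fin.< pos l
  pos-< {i} {l} i<l = ℕ.s≤s (subst₂ ℕ._<_ (sym (Fin.toℕ-inject₁ i)) (sym (Fin.toℕ-inject₁ l)) i<l)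

  pos-suc : toℕ j ≡ suc (toℕ i) → toℕ (pos j) ≡ suc (toℕ (pos i))
  pos-suc {j} {i} j≡1+i =
    cong suc (trans (Fin.toℕ-inject₁ j) (trans j≡1+i (cong suc (sym (Fin.toℕ-inject₁ i)))))

  ≢pos⇒≤⊎≥ : toℕ j ≡ suc (toℕ i) → toℕ l ≡ suc (toℕ j) → r ≢ pos j → r Fin.≤ pos i ⊎ pos l Fin.≤ r
  ≢pos⇒≤⊎≥ {j} {r = r} j≡1+i l≡1+j r≢ with Fin.<-cmp r (pos j)
  ... | tri< r<j _ _ = inj₁ (ℕ.≤-pred (subst (toℕ r ℕ.<_) (pos-suc j≡1+i) r<j))
  ... | tri≈ _ r≡j _ = contradiction r≡j r≢
  ... | tri> _ _ j<r = inj₂ (subst (ℕ._≤ toℕ r) (sym (pos-suc l≡1+j)) j<r)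

  ≥pos⇒≢pos : i Fin.< l → pos l Fin.≤ r → r ≢ pos i
  ≥pos⇒≢pos i<l l≤r = Fin.<⇒≢ (ℕ.<-≤-trans (pos-< i<l) l≤r) ∘ sym

  ≤pos⇒≢pos : l Fin.< i → r Fin.≤ pos l → r ≢ pos i
  ≤pos⇒≢pos l<i r≤l = Fin.<⇒≢ (ℕ.≤-<-trans r≤l (pos-< l<i))

  GenMinus-fixes : ∀ {I} γ → GenMinus P I Φ l γ → FixesOn (pos l Fin.≤_) Φ γ
  GenMinus-fixes _ (inj₁ (_ , _ , i<l , adj)) r l≤r = sym (proj₂ adj r (≥pos⇒≢pos i<l l≤r))
  GenMinus-fixes _ (inj₂ (inj₁ (_ , _ , _ , _ , j<l , k<l , _ , _ , adj₁ , adj₂))) r l≤r =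
    sym (trans (proj₂ adj₁ r (≥pos⇒≢pos j<l l≤r)) (proj₂ adj₂ r (≥pos⇒≢pos k<l l≤r)))
  GenMinus-fixes _ (inj₂ (inj₂ (_ , _ , _ , _ , j<l , i<l , _ , _ , _ , _ , adj₁ , adj₂ , adj₃))) r l≤r =
    sym (trans (proj₂ adj₁ r (≥pos⇒≢pos j<l l≤r))
        (trans (proj₂ adj₂ r (≥pos⇒≢pos i<l l≤r)) (proj₂ adj₃ r (≥pos⇒≢pos j<l l≤r))))

  GenPlus-fixes : ∀ {I} γ → GenPlus P I Φ l γ → FixesOn (Fin._≤ pos l) Φ γ
  GenPlus-fixes _ (inj₁ (_ , _ , l<i , adj)) r r≤l = sym (proj₂ adj r (≤pos⇒≢pos l<i r≤l))
  GenPlus-fixes _ (inj₂ (inj₁ (_ , _ , _ , _ , l<j , l<k , _ , _ , adj₁ , adj₂))) r r≤l =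
    sym (trans (proj₂ adj₁ r (≤pos⇒≢pos l<j r≤l)) (proj₂ adj₂ r (≤pos⇒≢pos l<k r≤l)))
  GenPlus-fixes _ (inj₂ (inj₂ (_ , _ , _ , _ , l<j , l<i , _ , _ , _ , _ , adj₁ , adj₂ , adj₃))) r r≤l =
    sym (trans (proj₂ adj₁ r (≤pos⇒≢pos l<j r≤l))
        (trans (proj₂ adj₂ r (≤pos⇒≢pos l<i r≤l)) (proj₂ adj₃ r (≤pos⇒≢pos l<j r≤l))))

  module Class2 {I : Fin n → Set} {Φ : FlagFn} (class : InClass2 P I Φ) where
    Φ-flag : IsFlag Φ
    Φ-flag = proj₁ (proj₂ class)

    Adj-¬SameOrbit : ¬ I i → IsFlag Ψ → Adj i Φ Ψ → ¬ SameOrbit P Φ Ψ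
    Adj-¬SameOrbit ¬Ii Ψ-flag Φ~Ψ = ¬Ii ∘ Equivalence.to (proj₂ (proj₂ class) _ _ Ψ-flag Φ~Ψ)

    Adj-SameOrbit : I i → SameOrbit P Φ Θ → IsFlag Ψ → Adj i Θ Ψ → SameOrbit P Φ Ψ
    Adj-SameOrbit {i} {Ψ = Ψ} Ii (x , Φx≗Θ) Ψ-flag Θ~Ψ =
      SameOrbit-trans (Equivalence.from (proj₂ (proj₂ class) _ _ (isFlag-⋆ (x ⁻¹ᴬ) Ψ-flag) Φ~Ψx⁻¹) Ii)
                      (x , λ r → to-from x (Ψ r))
      where
      Φ~Ψx⁻¹ : Adj i Φ (Ψ ⋆ x ⁻¹ᴬ)
      Φ~Ψx⁻¹ = Adj-resp (λ r → trans (cong (from x) (sym (Φx≗Θ r))) (from-to x (Φ r))) (λ _ → refl)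
                        (Adj-⋆ (x ⁻¹ᴬ) Θ~Ψ)

    α-exists : ¬ I i → I j → ∃ λ α → Adj3 i j i Φ (Φ ⋆ α)
    α-exists {i} {j} ¬Ii Ij with Adj-exists Φ-flag i
    ... | A , A-flag , Φ~A with Adj-exists A-flag j
    ... | X , X-flag , A~X with Adj-exists X-flag i
    ... | Y , Y-flag , X~Y with atMostTwoOrbits (proj₁ class) Φ-flag Y-flag A-flag
    ... | inj₁ (α , Φα≗Y) = α , A , X , A-flag , X-flag , Φ~A , A~X , Adj-resp (λ _ → refl) (sym ∘ Φα≗Y) X~Y
    ... | inj₂ A∈orbit⊎Y∼A =
      contradiction ([ id , Y∼A⇒A∈orbit ]′ A∈orbit⊎Y∼A) (Adj-¬SameOrbit ¬Ii A-flag Φ~A)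
      where
      -- Y x = A makes X x and Φ two i-neighbours of A.
      Y∼A⇒A∈orbit : SameOrbit P Y A → SameOrbit P Φ A
      Y∼A⇒A∈orbit (x , Yx≗A) = Adj-SameOrbit Ij (SameOrbit-sym (x , Xx≗Φ)) A-flag (Adj-sym A~X)
        where
        Xx≗Φ : X ⋆ x ≗ Φ
        Xx≗Φ = Adj-unique A-flag (isFlag-⋆ x X-flag) Φ-flag
                          (Adj-resp Yx≗A (λ _ → refl) (Adj-⋆ x (Adj-sym X~Y))) (Adj-sym Φ~A)

  module Lemma14
    (Φ : FlagFn) (j₀ k₀ : Fin n) (k₀≡j₀+2 : toℕ k₀ ≡ toℕ j₀ + 2)
    (class : InClass2 P (λ i → (i ≢ j₀) × (i ≢ k₀)) Φ) where
    open Class2 class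

    I : Fin n → Set
    I i = (i ≢ j₀) × (i ≢ k₀)

    Genα : Aut P → Set
    Genα γ = Σ (Fin n) λ m → (toℕ m ≡ suc (toℕ j₀)) × Adj3 j₀ m j₀ Φ (Φ ⋆ γ)

    toℕ-k₀ : toℕ k₀ ≡ suc (suc (toℕ j₀))
    toℕ-k₀ = trans k₀≡j₀+2 (ℕ.+-comm (toℕ j₀) 2)

    m : Fin n
    m = fromℕ< (ℕ.<-trans (ℕ.n<1+n _) (subst (ℕ._< n) toℕ-k₀ (Fin.toℕ<n k₀)))

    toℕ-m : toℕ m ≡ suc (toℕ j₀)
    toℕ-m = Fin.toℕ-fromℕ< _

    j₀<k₀ : j₀ Fin.< k₀
    j₀<k₀ = subst (suc (toℕ j₀) ℕ.≤_) (sym toℕ-k₀) (ℕ.n≤1+n _)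

    module _ (m′ : Fin n) (toℕ-m′ : toℕ m′ ≡ suc (toℕ j₀)) where
      j₀<m′ : j₀ Fin.< m′
      j₀<m′ = ℕ.≤-reflexive (sym toℕ-m′)

      m′<k₀ : m′ Fin.< k₀
      m′<k₀ = ℕ.≤-reflexive (trans (cong suc toℕ-m′) (sym toℕ-k₀))

      I-middle : I m′
      I-middle = Fin.<⇒≢ j₀<m′ ∘ sym , Fin.<⇒≢ m′<k₀

    ¬I-j₀ : ¬ I j₀
    ¬I-j₀ (j₀≢j₀ , _) = j₀≢j₀ refl

    ¬I-k₀ : ¬ I k₀
    ¬I-k₀ (_ , k₀≢k₀) = k₀≢k₀ refl

    ≢M⇒≤J⊎K≤ : r ≢ pos m → r Fin.≤ pos j₀ ⊎ pos k₀ Fin.≤ r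
    ≢M⇒≤J⊎K≤ = ≢pos⇒≤⊎≥ toℕ-m (trans toℕ-k₀ (cong suc (sym toℕ-m)))

    Genα-resp : ∀ x γ → Φ ⋆ x ≗ Φ ⋆ γ → Genα x → Genα γ
    Genα-resp _ _ Φx≗Φγ (m′ , toℕ-m′ , adj) = m′ , toℕ-m′ , Adj3-respʳ Φx≗Φγ adj

    Genα-inhabited : ∃ Genα
    Genα-inhabited = map₂ (λ adj → m , toℕ-m , adj) (α-exists ¬I-j₀ (I-middle m toℕ-m))

    -- Φ^{k₀,k₀} = Φ, so an automorphism fixing Φ is a generator α_{k₀,k₀} of Γ⁺_{j₀}.
    fixer∈Γ⁺ : Φ ⋆ x ≗ Φ → Γ⁺ P I Φ j₀ x
    fixer∈Γ⁺ Φx≗Φ with Adj-exists Φ-flag k₀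
    ... | B , B-flag , Φ~B =
      gen (inj₂ (inj₁ (k₀ , k₀ , ¬I-k₀ , ¬I-k₀ , j₀<k₀ , j₀<k₀ , Adj2-back B-flag Φ~B (sym ∘ Φx≗Φ))))

    ⟨α⟩⊆Γ⁻ : ⟨_⟩ P Genα g → Γ⁻ P I Φ k₀ g
    ⟨α⟩⊆Γ⁻ = ⟨⟩-mono λ (m′ , toℕ-m′ , adj) →
      inj₂ (inj₂ (j₀ , m′ , ¬I-j₀ , I-middle m′ toℕ-m′ , j₀<k₀ , m′<k₀ m′ toℕ-m′ , adj))

    module _ (a : Aut P) (ha : Adj2 j₀ k₀ Φ (Φ ⋆ a)) where
      private
        A : FlagFn
        A = proj₁ ha

        A-flag : IsFlag A
        A-flag = proj₁ (proj₂ ha)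

        Φ~A : Adj j₀ Φ A
        Φ~A = proj₁ (proj₂ (proj₂ ha))

        A~Φa : Adj k₀ A (Φ ⋆ a)
        A~Φa = proj₂ (proj₂ (proj₂ ha))

        A-off-M : (∀ r → r Fin.≤ pos j₀ → Ψ r ≡ to a (Φ r)) → (∀ r → pos k₀ Fin.≤ r → Ψ r ≡ Φ r) →
                  ∀ r → r ≢ pos m → A r ≡ Ψ r
        A-off-M low high r r≢M =
          [ (λ r≤J → trans (proj₂ A~Φa r (≤pos⇒≢pos j₀<k₀ r≤J)) (sym (low r r≤J)))
          , (λ K≤r → trans (sym (proj₂ Φ~A r (≥pos⇒≢pos j₀<k₀ K≤r))) (sym (high r K≤r)))
          ]′ (≢M⇒≤J⊎K≤ r≢M)

      Γ⁻∩Γ⁺α-empty : ∀ g d → Γ⁻ P I Φ k₀ g → Γ⁺ P I Φ j₀ d → ¬ (_≈_ P g (d ∙ a))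
      Γ⁻∩Γ⁺α-empty g d g∈Γ⁻ d∈Γ⁺ g≈da =
        [ (λ A≗Φg → A∉orbit (g , sym ∘ A≗Φg))
        , (λ A~Φg → A∉orbit (Adj-SameOrbit (I-middle m toℕ-m) (g , λ _ → refl) A-flag (Adj-sym A~Φg)))
        ]′ (≗⊎Adj A-flag (isFlag-⋆ g Φ-flag) (A-off-M low (⟨⟩-fixes GenMinus-fixes g∈Γ⁻)))
        where
        A∉orbit : ¬ SameOrbit P Φ A
        A∉orbit = Adj-¬SameOrbit ¬I-j₀ A-flag Φ~A

        low : ∀ r → r Fin.≤ pos j₀ → to g (Φ r) ≡ to a (Φ r)
        low r r≤J = trans (g≈da (Φ r)) (cong (to a) (⟨⟩-fixes GenPlus-fixes d∈Γ⁺ r r≤J))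

      Γ⁻∩αΓ⁺α⊆⟨α⟩ : ∀ b → Adj2 k₀ j₀ Φ (Φ ⋆ b) → ∀ {g d} → Γ⁻ P I Φ k₀ g → Γ⁺ P I Φ j₀ d →
                    _≈_ P g ((b ∙ d) ∙ a) → ⟨_⟩ P Genα g
      Γ⁻∩αΓ⁺α⊆⟨α⟩ b hb {g} {d} g∈Γ⁻ d∈Γ⁺ g≈bda =
        [ fixes-A , moves-A ]′ (≗⊎Adj A-flag (isFlag-⋆ g A-flag) (A-off-M low high))
        where
        low : ∀ r → r Fin.≤ pos j₀ → to g (A r) ≡ to a (Φ r)
        low r r≤J = begin
          to g (A r)                      ≡⟨ cong (to g) (proj₂ A~Φa r (≤pos⇒≢pos j₀<k₀ r≤J)) ⟩
          to g (to a (Φ r))               ≡⟨ g≈bda _ ⟩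
          to a (to d (to b (to a (Φ r)))) ≡⟨ cong (to a ∘ to d) (Adj2-inverse Φ-flag a b ha hb r) ⟩
          to a (to d (Φ r))               ≡⟨ cong (to a) (⟨⟩-fixes GenPlus-fixes d∈Γ⁺ r r≤J) ⟩
          to a (Φ r)                      ∎
          where open ≡-Reasoning

        high : ∀ r → pos k₀ Fin.≤ r → to g (A r) ≡ Φ r
        high r K≤r = trans (cong (to g) (sym (proj₂ Φ~A r (≥pos⇒≢pos j₀<k₀ K≤r))))
                           (⟨⟩-fixes GenMinus-fixes g∈Γ⁻ r K≤r)

        moves-A : Adj m A (A ⋆ g) → ⟨_⟩ P Genα g
        moves-A A~Ag =
          gen (m , toℕ-m , A , A ⋆ g , A-flag , isFlag-⋆ g A-flag , Φ~A , A~Ag , Adj-⋆ g (Adj-sym Φ~A))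

        fixes-A : A ≗ A ⋆ g → ⟨_⟩ P Genα g
        fixes-A A≗Ag = fixer∈⟨⟩ Genα-resp Genα-inhabited
          (Adj-unique A-flag (isFlag-⋆ g Φ-flag) Φ-flag
                      (Adj-resp (sym ∘ A≗Ag) (λ _ → refl) (Adj-⋆ g (Adj-sym Φ~A))) (Adj-sym Φ~A))

      conj∈GenPlus : ∀ γ → Genα γ → GenPlus P I Φ j₀ ((a ∙ γ) ∙ a ⁻¹ᴬ)
      conj∈GenPlus γ (m′ , toℕ-m′ , adj) =
        inj₂ (inj₂ (k₀ , m′ , ¬I-k₀ , I-middle m′ toℕ-m′ , j₀<k₀ , j₀<m′ m′ toℕ-m′ ,
                    Adj3-conj A-flag a A~Φa γ (Adj3-middle Φ-flag A-flag Φ~A γ adj)))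

      ⟨α⟩⊆αΓ⁺α : ∀ b → Adj2 k₀ j₀ Φ (Φ ⋆ b) → ⟨_⟩ P Genα g →
                 ∃ λ d → Γ⁺ P I Φ j₀ d × _≈_ P g ((b ∙ d) ∙ a)
      ⟨α⟩⊆αΓ⁺α {g} b hb g∈⟨α⟩ =
        (b ⁻¹ᴬ ∙ g) ∙ a ⁻¹ᴬ ,
        resp (λ F → cong (from a ∘ to g) (to-from a (from b F))) (mul ab⁻¹∈Γ⁺ aga⁻¹∈Γ⁺) ,
        λ F → sym (trans (to-from a _) (cong (to g) (from-to b F)))
        where
        ab⁻¹∈Γ⁺ : Γ⁺ P I Φ j₀ ((a ∙ b) ⁻¹ᴬ)
        ab⁻¹∈Γ⁺ = fixer∈Γ⁺ (⁻¹-fixes (a ∙ b) (Adj2-inverse Φ-flag a b ha hb))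

        aga⁻¹∈Γ⁺ : Γ⁺ P I Φ j₀ ((a ∙ g) ∙ a ⁻¹ᴬ)
        aga⁻¹∈Γ⁺ = ⟨⟩-conj a conj∈GenPlus g∈⟨α⟩

lemma14 : {n : ℕ} (P : Polytope n) (Φ : Polytope.FlagFn P) (j₀ k₀ : Fin n) →
    toℕ k₀ ≡ toℕ j₀ + 2 →
    InClass2 P (λ i → (i ≢ j₀) × (i ≢ k₀)) Φ →
    (∀ (a : Aut P) → Polytope.Adj2 P j₀ k₀ Φ (_·ᶠ_ P Φ a) →
      ∀ (g d : Aut P) → Γ⁻ P (λ i → (i ≢ j₀) × (i ≢ k₀)) Φ k₀ g →
        Γ⁺ P (λ i → (i ≢ j₀) × (i ≢ k₀)) Φ j₀ d →
        ¬ (_≈_ P g (_·_ P d a)))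
    ×
    (∀ (a b : Aut P) → Polytope.Adj2 P j₀ k₀ Φ (_·ᶠ_ P Φ a) →
      Polytope.Adj2 P k₀ j₀ Φ (_·ᶠ_ P Φ b) →
      ∀ (g : Aut P) →
        ((Γ⁻ P (λ i → (i ≢ j₀) × (i ≢ k₀)) Φ k₀ g ×
          (∃ λ d → Γ⁺ P (λ i → (i ≢ j₀) × (i ≢ k₀)) Φ j₀ d ×
                   _≈_ P g (_·_ P (_·_ P b d) a)))
         ⇔ ⟨_⟩ P (λ γ → Σ (Fin n) λ m → (toℕ m ≡ suc (toℕ j₀)) ×
                         Polytope.Adj3 P j₀ m j₀ Φ (_·ᶠ_ P Φ γ)) g))
lemma14 P Φ j₀ k₀ k₀≡j₀+2 class =
  Γ⁻∩Γ⁺α-empty ,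
  λ a b ha hb _ → mk⇔ (λ (g∈Γ⁻ , _ , d∈Γ⁺ , g≈bda) → Γ⁻∩αΓ⁺α⊆⟨α⟩ a ha b hb g∈Γ⁻ d∈Γ⁺ g≈bda)
                      (λ g∈⟨α⟩ → ⟨α⟩⊆Γ⁻ g∈⟨α⟩ , ⟨α⟩⊆αΓ⁺α a ha b hb g∈⟨α⟩)
  where open Lemma14 P Φ j₀ k₀ k₀≡j₀+2 class
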